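{- Let $D\ge2$, let $\mathcal{B}$ be a bubble with $\mathcal{V}$ white vertices and $\Omega$ a pairing of $\mathcal{B}$. Then the number of faces of the covering $\mathcal{B}^\Omega$ satisfies $$\mathcal{F}(\mathcal{B}^\Omega)=1+(D-1)\mathcal{V}-\mathrm{opt}_{\mathcal{B}}(\Omega).$$
   Context: Write $[D]=\{1,\dots,D\}$. A bubble is a finite connected bipartite graph (multiple edges allowed) with edges colored in $[D]$, each vertex incident to exactly one edge of each color. A pairing $\Omega$ partitions its vertices into pairs of one white and one black vertex. The covering $\mathcal{B}^\Omega$ is obtained from $\mathcal{B}$ by adding an edge of color $0$ between the two vertices of each pair; $\mathcal{F}(\mathcal{B}^\Omega)$ is the total number, over $i\in[D]$, of cycles of $\mathcal{B}^\Omega$ alternating edges of colors $0$ and $i$. $\mathcal{B}_{\circlearrowleft,\Omega}$ is the directed multigraph obtained from $\mathcal{B}$ by orienting edges from white to black, contracting each pair of $\Omega$ to a single vertex and deleting the edges joining the two vertices of a pair; $\mathcal{B}^{(i)}_{\circlearrowleft,\Omega}$ keeps all its vertices and only its edges of color $i$. For a multigraph with $\mathcal{V}$ vertices, $\mathcal{E}$ edges and $k$ components, the circuit rank is $l=\mathcal{E}-\mathcal{V}+k$. The optimality of $\Omega$ is $\mathrm{opt}_{\mathcal{B}}(\Omega)=l(\mathcal{B}_{\circlearrowleft,\Omega})-\sum_{i=1}^D l(\mathcal{B}^{(i)}_{\circlearrowleft,\Omega})$. -}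

module Defs where

open import Data.Nat using (ℕ; _≤_; _∸_; _*_) renaming (_+_ to _+ℕ_)
open import Data.Integer using (ℤ; +_; _+_; _-_)
open import Data.Fin using (Fin; _↑ˡ_; _↑ʳ_; _≟_)
open import Data.Fin.Permutation using (Permutation′; _⟨$⟩ʳ_; _⟨$⟩ˡ_)
open import Data.List using (List; []; _∷_; map; concatMap; filter; length; foldr; allFin)
open import Data.Nat.ListAction using (sum)
open import Data.List.Membership.Propositional using (_∈_)
open import Data.Product using (_×_; _,_; ∃)
open import Relation.Binary.PropositionalEquality using (_≡_)
open import Relation.Nullary.Decidable using (¬?)
open import Relation.Binary.Construct.Closure.Equivalence using (EqClosure)

-- Finite undirected multigraphs on vertex set Fin nV; the edges form a
-- list (so multiple edges and loops are allowed). Orientation of an edge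
-- (u , v) is irrelevant for connectivity and circuit rank.

record Multigraph : Set where
  field
    nV    : ℕ
    edges : List (Fin nV × Fin nV)
open Multigraph public

Adj : (G : Multigraph) → Fin (nV G) → Fin (nV G) → Set
Adj G u v = (u , v) ∈ edges G

Conn : (G : Multigraph) → Fin (nV G) → Fin (nV G) → Set
Conn G = EqClosure (Adj G)

IsConnected : Multigraph → Set
IsConnected G = ∀ u v → Conn G u v

record Components (G : Multigraph) : Set where
  field
    k        : ℕ
    label    : Fin (nV G) → Fin k
    surj     : ∀ c → ∃ λ v → label v ≡ c
    sound    : ∀ u v → label u ≡ label v → Conn G u v
    complete : ∀ u v → Conn G u v → label u ≡ label v
open Components public

circuitRank : (G : Multigraph) → Components G → ℤ
circuitRank G C = (+ length (edges G) - + nV G) + + k C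

-- Colours [D] = {1,…,D} are represented by Fin D. White vertices
-- and black vertices are both indexed by Fin V; the edge of colour i at
-- the white vertex w goes to the black vertex  col i ⟨$⟩ʳ w.  (Each vertex
-- is incident to exactly one edge of each colour iff each colour class is
-- a perfect matching, i.e. a bijection white → black.)

record Bubble (D : ℕ) : Set where
  field
    V   : ℕ
    col : Fin D → Permutation′ V
open Bubble public

module _ {D : ℕ} (B : Bubble D) where

  white : Fin (V B) → Fin (V B +ℕ V B)
  white w = w ↑ˡ V B

  black : Fin (V B) → Fin (V B +ℕ V B)
  black b = V B ↑ʳ b

  colourEdges : Fin D → List (Fin (V B +ℕ V B) × Fin (V B +ℕ V B))
  colourEdges i = map (λ w → white w , black (col B i ⟨$⟩ʳ w)) (allFin (V B))

  bubbleGraph : Multigraph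
  bubbleGraph = record { nV = V B +ℕ V B ; edges = concatMap colourEdges (allFin D) }

  IsBubble : Set
  IsBubble = (1 ≤ V B) × IsConnected bubbleGraph

  -- A pairing: white w is paired with black  Ω ⟨$⟩ʳ w.
  Pairing : Set
  Pairing = Permutation′ (V B)

  module _ (Ω : Pairing) where

    colour0Edges : List (Fin (V B +ℕ V B) × Fin (V B +ℕ V B))
    colour0Edges = map (λ w → white w , black (Ω ⟨$⟩ʳ w)) (allFin (V B))

    -- subgraph of the covering B^Ω with the edges of colours 0 and i;
    -- every vertex has degree 2, so its components are exactly the cycles
    -- alternating colours 0 and i (the faces of colour i).
    faceGraph : Fin D → Multigraph
    faceGraph i = record { nV = V B +ℕ V B ; edges = colour0Edges ++ colourEdges i }
      where open Data.List using (_++_)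

    faces : ((i : Fin D) → Components (faceGraph i)) → ℕ
    faces fc = sum (map (λ i → k (fc i)) (allFin D))

    -- Contracted graph B_{↺,Ω}: the pair {w , Ω w} is the vertex w.
    -- The colour-i edge at white w (oriented white → black) becomes an edge
    -- from pair w to the pair of the black vertex col i w, i.e. to
    -- Ω⁻¹(col i w); it is deleted when it joins the two vertices of a pair,
    -- i.e. when col i w ≡ Ω w.
    contractedEdges : Fin D → List (Fin (V B) × Fin (V B))
    contractedEdges i =
      map (λ w → w , Ω ⟨$⟩ˡ (col B i ⟨$⟩ʳ w))
          (filter (λ w → ¬? ((col B i ⟨$⟩ʳ w) ≟ (Ω ⟨$⟩ʳ w))) (allFin (V B)))

    contracted : Multigraph
    contracted = record { nV = V B ; edges = concatMap contractedEdges (allFin D) }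

    contractedColour : Fin D → Multigraph
    contractedColour i = record { nV = V B ; edges = contractedEdges i }

    sumℤ : List ℤ → ℤ
    sumℤ = foldr _+_ (+ 0)

    opt : Components contracted → ((i : Fin D) → Components (contractedColour i)) → ℤ
    opt cc ci = circuitRank contracted cc
                - sumℤ (map (λ i → circuitRank (contractedColour i) (ci i)) (allFin D))

module Submission where

-- Contract every pair {w , Ω w} of the covering to one vertex.
-- (1) For each colour i this contraction identifies the connected components
--     of the face graph (edges of colours 0 and i) with those of the
--     contracted colour-i graph: the colour-0 edges are exactly the contracted
--     pairs.  Hence F(B^Ω) = Σᵢ kᵢ, where kᵢ counts components of B^{(i)}_{↺,Ω}.
-- (2) Contraction preserves connectivity, so B_{↺,Ω} is connected: k = 1.
-- (3) The edges of B_{↺,Ω} are the disjoint union of its colour classes, so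
--     with S the number of its edges,  l(B_{↺,Ω}) = S - V + 1  and
--     Σᵢ l(B^{(i)}_{↺,Ω}) = S - D·V + F(B^Ω);  subtracting gives the formula.

open import Defs
open import Data.Nat using (ℕ; _≤_; _∸_; _*_; zero; suc) renaming (_+_ to _+ℕ_)
open import Data.Nat.Properties using (≤-antisym)
open import Data.Integer using (ℤ; +_; _+_; _-_)
open import Data.Fin using (Fin; splitAt; fromℕ<; _≟_)
open import Data.Fin.Properties using (splitAt-↑ˡ; splitAt-↑ʳ; splitAt⁻¹-↑ˡ; splitAt⁻¹-↑ʳ; injective⇒≤; 0≢1+n)
open import Data.Fin.Permutation using (_⟨$⟩ʳ_; _⟨$⟩ˡ_; inverseˡ; inverseʳ)
open import Data.List using (List; []; _∷_; map; concatMap; length; foldr; allFin; _++_)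
open import Data.List.Properties using (length-++; length-tabulate; map-cong)
open import Data.Nat.ListAction using (sum)
open import Data.List.Membership.Propositional using (lose)
open import Data.List.Membership.Propositional.Properties
  using (∈-map⁺; ∈-map⁻; ∈-++⁺ˡ; ∈-++⁺ʳ; ∈-++⁻; ∈-concatMap⁺; ∈-concatMap⁻; ∈-map∘filter⁺; ∈-map∘filter⁻; ∈-allFin)
open import Data.List.Relation.Unary.Any using (satisfied)
open import Data.Product using (_×_; _,_; ∃; proj₁; proj₂)
open import Data.Sum using (inj₁; inj₂; [_,_]′)
open import Data.Empty using (⊥-elim)
open import Relation.Nullary using (yes; no)
open import Relation.Nullary.Decidable using (¬?)
open import Relation.Binary.PropositionalEquality using (_≡_; refl; sym; trans; cong; cong₂; subst; subst₂; module ≡-Reasoning)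
open import Relation.Binary.Construct.Closure.Equivalence using (gfold)
import Relation.Binary.Construct.Closure.Equivalence as EC
open import Relation.Binary.Construct.Closure.Symmetric using (fwd; bwd)
open import Relation.Binary.Construct.Closure.ReflexiveTransitive using (ε; _◅_; _◅◅_)
import Data.Integer.Properties as ℤP
open import Data.Integer.Tactic.RingSolver using (solve-∀)

mapConn : (G H : Multigraph) (f : Fin (nV G) → Fin (nV H))
  → (∀ {u v} → Adj G u v → Conn H (f u) (f v))
  → ∀ {u v} → Conn G u v → Conn H (f u) (f v)
mapConn G H f edge = gfold (EC.isEquivalence (Adj H)) f edge

record ConnEquiv (G H : Multigraph) : Set where
  field
    to        : Fin (nV G) → Fin (nV H)
    from      : Fin (nV H) → Fin (nV G)
    to-conn   : ∀ {u v} → Conn G u v → Conn H (to u) (to v)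
    from-conn : ∀ {u v} → Conn H u v → Conn G (from u) (from v)
    from-to   : ∀ v → Conn G (from (to v)) v
    to-from   : ∀ u → Conn H (to (from u)) u

ConnEquiv-sym : ∀ {G H} → ConnEquiv G H → ConnEquiv H G
ConnEquiv-sym e = record
  { to = from ; from = to ; to-conn = from-conn ; from-conn = to-conn
  ; from-to = to-from ; to-from = from-to }
  where open ConnEquiv e

componentMap : ∀ {G H} → ConnEquiv G H → (CG : Components G) (CH : Components H)
  → Fin (k CG) → Fin (k CH)
componentMap e CG CH c = label CH (ConnEquiv.to e (proj₁ (surj CG c)))

componentMap-inverse : ∀ {G H} (e : ConnEquiv G H) (CG : Components G) (CH : Components H)
  → ∀ c → componentMap (ConnEquiv-sym e) CH CG (componentMap e CG CH c) ≡ c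
componentMap-inverse {G} e CG CH c =
  trans (complete CG _ _ back) (proj₂ (surj CG c))
  where
  open ConnEquiv e
  v = proj₁ (surj CG c)
  rep = surj CH (label CH (to v))
  back : Conn G (from (proj₁ rep)) v
  back = from-conn (sound CH _ _ (proj₂ rep)) ◅◅ from-to v

leftInverse⇒≤ : ∀ {m n} (f : Fin m → Fin n) (g : Fin n → Fin m)
  → (∀ x → g (f x) ≡ x) → m ≤ n
leftInverse⇒≤ f g gf = injective⇒≤ {f = f} λ {x} {y} fx≡fy →
  trans (sym (gf x)) (trans (cong g fx≡fy) (gf y))

componentCount-≡ : ∀ {G H} → ConnEquiv G H → (CG : Components G) (CH : Components H)
  → k CG ≡ k CH
componentCount-≡ e CG CH = ≤-antisym
  (leftInverse⇒≤ (componentMap e CG CH) (componentMap e′ CH CG) (componentMap-inverse e CG CH))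
  (leftInverse⇒≤ (componentMap e′ CH CG) (componentMap e CG CH) (componentMap-inverse e′ CH CG))
  where e′ = ConnEquiv-sym e

constantSurjection⇒1 : ∀ {m n} → Fin m → (f : Fin m → Fin n)
  → (∀ c → ∃ λ v → f v ≡ c) → (∀ u v → f u ≡ f v) → n ≡ 1
constantSurjection⇒1 {n = zero} v f _ _ with f v
... | ()
constantSurjection⇒1 {n = suc zero} _ _ _ _ = refl
constantSurjection⇒1 {n = suc (suc _)} _ _ onto const =
  ⊥-elim (0≢1+n (trans (sym (proj₂ (onto Fin.zero)))
                (trans (const _ _) (proj₂ (onto (Fin.suc Fin.zero))))))
  where import Data.Fin as Fin

connected⇒oneComponent : (G : Multigraph) → 1 ≤ nV G → IsConnected G
  → (C : Components G) → k C ≡ 1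
connected⇒oneComponent G 1≤n conn C =
  constantSurjection⇒1 (fromℕ< 1≤n) (label C) (surj C)
    (λ u v → complete C u v (conn u v))

graphOn : (n : ℕ) → List (Fin n × Fin n) → Multigraph
graphOn n es = record { nV = n ; edges = es }

sumCircuitRanks : ∀ {n} {I : Set} (E : I → List (Fin n × Fin n))
  (C : ∀ i → Components (graphOn n (E i))) (xs : List I)
  → foldr _+_ (+ 0) (map (λ i → circuitRank (graphOn n (E i)) (C i)) xs)
    ≡ (+ length (concatMap E xs) - + (length xs * n)) + + sum (map (λ i → k (C i)) xs)
sumCircuitRanks E C [] = refl
sumCircuitRanks {n} E C (i ∷ xs) = begin
  ((+ a - + n) + + c) + foldr _+_ (+ 0) (map (λ j → circuitRank _ (C j)) xs)
    ≡⟨ cong (λ r → ((+ a - + n) + + c) + r) (sumCircuitRanks E C xs) ⟩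
  ((+ a - + n) + + c) + ((+ b - + m) + + s)
    ≡⟨ regroup (+ a) (+ b) (+ n) (+ m) (+ c) (+ s) ⟩
  ((+ a + + b) - (+ n + + m)) + (+ c + + s)
    ≡⟨ sym (cong₂ _+_ (cong₂ _-_ length-split (ℤP.pos-+ n m)) (ℤP.pos-+ c s)) ⟩
  (+ length (E i ++ concatMap E xs) - + (n +ℕ m)) + + (c +ℕ s) ∎
  where
  open ≡-Reasoning
  a = length (E i)
  b = length (concatMap E xs)
  c = k (C i)
  m = length xs * n
  s = sum (map (λ j → k (C j)) xs)
  regroup : ∀ (a b v w x y : ℤ) → ((a - v) + x) + ((b - w) + y) ≡ ((a + b) - (v + w)) + (x + y)
  regroup = solve-∀
  length-split : + length (E i ++ concatMap E xs) ≡ + a + + b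
  length-split = trans (cong +_ (length-++ (E i))) (ℤP.pos-+ a b)

eulerRearrangement : ∀ (S F : ℤ) (V d : ℕ)
  → F ≡ (+ 1 + + (d * V)) - (((S - + V) + + 1) - ((S - + (suc d * V)) + F))
eulerRearrangement S F V d =
  subst (λ dV → F ≡ (+ 1 + + (d * V)) - (((S - + V) + + 1) - ((S - dV) + F)))
        (sym (ℤP.pos-+ V (d * V)))
        (rearrange S (+ V) (+ (d * V)) F)
  where
  rearrange : ∀ (S v dv F : ℤ) → F ≡ (+ 1 + dv) - (((S - v) + + 1) - ((S - (v + dv)) + F))
  rearrange = solve-∀

module Contraction {D : ℕ} (B : Bubble D) (Ω : Pairing B) where

  pairOf : Fin (V B +ℕ V B) → Fin (V B)
  pairOf v = [ (λ w → w) , (λ b → Ω ⟨$⟩ˡ b) ]′ (splitAt (V B) v)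

  pairOf-white : ∀ w → pairOf (white B w) ≡ w
  pairOf-white w rewrite splitAt-↑ˡ (V B) w (V B) = refl

  pairOf-black : ∀ b → pairOf (black B b) ≡ Ω ⟨$⟩ˡ b
  pairOf-black b rewrite splitAt-↑ʳ (V B) (V B) b = refl

  -- The colour-i edge at w survives in the contracted colour-i graph, unless
  -- it joins the two vertices of a pair, in which case its ends coincide.
  colourEdge-contracted : ∀ i w
    → Conn (contractedColour B Ω i) w (Ω ⟨$⟩ˡ (col B i ⟨$⟩ʳ w))
  colourEdge-contracted i w with (col B i ⟨$⟩ʳ w) ≟ (Ω ⟨$⟩ʳ w)
  ... | yes inPair =
    subst (Conn (contractedColour B Ω i) w)
          (sym (trans (cong (Ω ⟨$⟩ˡ_) inPair) (inverseˡ Ω))) ε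
  ... | no notInPair =
    fwd (∈-map∘filter⁺ (λ x → x , Ω ⟨$⟩ˡ (col B i ⟨$⟩ʳ x))
                       (λ x → ¬? ((col B i ⟨$⟩ʳ x) ≟ (Ω ⟨$⟩ʳ x)))
                       (w , ∈-allFin w , refl , notInPair)) ◅ ε

  colour⊆contracted : ∀ i {u v}
    → Conn (contractedColour B Ω i) u v → Conn (contracted B Ω) u v
  colour⊆contracted i =
    EC.map (λ e → ∈-concatMap⁺ (contractedEdges B Ω) (lose (∈-allFin i) e))

  bubbleEdge-contracted : ∀ {u v} → Adj (bubbleGraph B) u v
    → Conn (contracted B Ω) (pairOf u) (pairOf v)
  bubbleEdge-contracted e with satisfied (∈-concatMap⁻ (colourEdges B) {xs = allFin D} e)
  ... | i , e∈i with ∈-map⁻ (λ w → white B w , black B (col B i ⟨$⟩ʳ w)) e∈i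
  ... | w , _ , refl rewrite pairOf-white w | pairOf-black (col B i ⟨$⟩ʳ w) =
    colour⊆contracted i (colourEdge-contracted i w)

  contracted-connected : IsConnected (bubbleGraph B) → IsConnected (contracted B Ω)
  contracted-connected connB u v =
    subst₂ (Conn (contracted B Ω)) (pairOf-white u) (pairOf-white v)
      (mapConn (bubbleGraph B) (contracted B Ω) pairOf bubbleEdge-contracted
               (connB (white B u) (white B v)))

  module _ (i : Fin D) where

    pairEdge : ∀ b → Adj (faceGraph B Ω i) (white B (Ω ⟨$⟩ˡ b)) (black B b)
    pairEdge b =
      subst (λ z → Adj (faceGraph B Ω i) (white B (Ω ⟨$⟩ˡ b)) (black B z)) (inverseʳ Ω)
        (∈-++⁺ˡ (∈-map⁺ (λ x → white B x , black B (Ω ⟨$⟩ʳ x)) (∈-allFin (Ω ⟨$⟩ˡ b))))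

    -- Colour-0 edges collapse to a point, colour-i edges to contracted edges.
    faceEdge-contracted : ∀ {u v} → Adj (faceGraph B Ω i) u v
      → Conn (contractedColour B Ω i) (pairOf u) (pairOf v)
    faceEdge-contracted e with ∈-++⁻ (colour0Edges B Ω) e
    ... | inj₁ e∈0 with ∈-map⁻ (λ w → white B w , black B (Ω ⟨$⟩ʳ w)) e∈0
    ...   | w , _ , refl rewrite pairOf-white w | pairOf-black (Ω ⟨$⟩ʳ w) | inverseˡ Ω {w} = ε
    faceEdge-contracted e | inj₂ e∈i with ∈-map⁻ (λ w → white B w , black B (col B i ⟨$⟩ʳ w)) e∈i
    ...   | w , _ , refl rewrite pairOf-white w | pairOf-black (col B i ⟨$⟩ʳ w) =
      colourEdge-contracted i w

    -- A contracted colour-i edge lifts to a colour-i edge followed by the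
    -- colour-0 edge back to the white vertex of the target pair.
    contractedEdge-lift : ∀ {u v} → Adj (contractedColour B Ω i) u v
      → Conn (faceGraph B Ω i) (white B u) (white B v)
    contractedEdge-lift e
      with ∈-map∘filter⁻ (λ x → x , Ω ⟨$⟩ˡ (col B i ⟨$⟩ʳ x))
                         (λ x → ¬? ((col B i ⟨$⟩ʳ x) ≟ (Ω ⟨$⟩ʳ x))) {xs = allFin (V B)} e
    ... | w , _ , refl , _ =
      fwd (∈-++⁺ʳ (colour0Edges B Ω) (∈-map⁺ (λ x → white B x , black B (col B i ⟨$⟩ʳ x)) (∈-allFin w)))
      ◅ bwd (pairEdge (col B i ⟨$⟩ʳ w)) ◅ ε

    toPairRep : ∀ v → Conn (faceGraph B Ω i) (white B (pairOf v)) v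
    toPairRep v with splitAt (V B) v in eq
    ... | inj₁ w = subst (Conn (faceGraph B Ω i) (white B w)) (splitAt⁻¹-↑ˡ eq) ε
    ... | inj₂ b = subst (Conn (faceGraph B Ω i) (white B (Ω ⟨$⟩ˡ b))) (splitAt⁻¹-↑ʳ eq)
                         (fwd (pairEdge b) ◅ ε)

    face≃contractedColour : ConnEquiv (faceGraph B Ω i) (contractedColour B Ω i)
    face≃contractedColour = record
      { to        = pairOf
      ; from      = white B
      ; to-conn   = mapConn (faceGraph B Ω i) (contractedColour B Ω i) pairOf faceEdge-contracted
      ; from-conn = mapConn (contractedColour B Ω i) (faceGraph B Ω i) (white B) contractedEdge-lift
      ; from-to   = toPairRep
      ; to-from   = λ w → subst (Conn (contractedColour B Ω i) (pairOf (white B w))) (pairOf-white w) ε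
      }

  faces≡colourComponents : (fc : (i : Fin D) → Components (faceGraph B Ω i))
    (ci : (i : Fin D) → Components (contractedColour B Ω i))
    → faces B Ω fc ≡ sum (map (λ i → k (ci i)) (allFin D))
  faces≡colourComponents fc ci =
    cong sum (map-cong (λ i → componentCount-≡ (face≃contractedColour i) (fc i) (ci i)) (allFin D))

  opt-formula : IsBubble B → (fc : (i : Fin D) → Components (faceGraph B Ω i))
    (cc : Components (contracted B Ω)) (ci : (i : Fin D) → Components (contractedColour B Ω i))
    → opt B Ω cc ci
      ≡ ((+ length (concatMap (contractedEdges B Ω) (allFin D)) - + V B) + + 1)
        - ((+ length (concatMap (contractedEdges B Ω) (allFin D)) - + (D * V B)) + + faces B Ω fc)
  opt-formula (nonempty , connB) fc cc ci = begin
    circuitRank (contracted B Ω) cc - ranks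
      ≡⟨ cong (λ n → (S - + V B) + + n - ranks)
              (connected⇒oneComponent (contracted B Ω) nonempty (contracted-connected connB) cc) ⟩
    (S - + V B) + + 1 - ranks
      ≡⟨ cong (λ r → (S - + V B) + + 1 - r) (sumCircuitRanks (contractedEdges B Ω) ci (allFin D)) ⟩
    (S - + V B) + + 1 - ((S - + (length (allFin D) * V B)) + + sum (map (λ i → k (ci i)) (allFin D)))
      ≡⟨ cong₂ (λ n F → (S - + V B) + + 1 - ((S - + (n * V B)) + + F))
               (length-tabulate {n = D} (λ i → i)) (sym (faces≡colourComponents fc ci)) ⟩
    (S - + V B) + + 1 - ((S - + (D * V B)) + + faces B Ω fc) ∎
    where
    open ≡-Reasoning
    S = + length (concatMap (contractedEdges B Ω) (allFin D))
    ranks = sumℤ B Ω (map (λ i → circuitRank (contractedColour B Ω i) (ci i)) (allFin D))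

lemma6 : (D : ℕ) → 2 ≤ D → (B : Bubble D) → IsBubble B → (Ω : Pairing B)
    → (fc : (i : Fin D) → Components (faceGraph B Ω i))
    → (cc : Components (contracted B Ω))
    → (ci : (i : Fin D) → Components (contractedColour B Ω i))
    → + faces B Ω fc ≡ (+ 1 + + ((D ∸ 1) * V B)) - opt B Ω cc ci
lemma6 (suc d) _ B isB Ω fc cc ci =
  trans (eulerRearrangement S (+ faces B Ω fc) (V B) d)
        (cong (λ o → (+ 1 + + (d * V B)) - o) (sym (Contraction.opt-formula B Ω isB fc cc ci)))
  where S = + length (concatMap (contractedEdges B Ω) (allFin (suc d)))
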